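{- Let $G$ be a finite abelian group of order $n\ge 2$ and $h$ a positive integer with $h\le n-1$. Then $Z_h(G)\ge h+1$ if and only if there exists a subset $A\subseteq G$ of size $h+1$ with $s(A)\notin A$.
   Context: $G$ is written additively. For a finite subset $A\subseteq G$, $s(A)$ denotes the sum of its elements. For $A\subseteq G$ and a positive integer $h$, $h\hat{\;}A$ denotes the set of all sums of $h$ pairwise distinct elements of $A$. $Z_h(G)=\max\{|A| : A\subseteq G,\ 0\notin h\hat{\;}A\}$. -}

module Defs where

open import Level using (Level)
open import Data.Nat using (ℕ; zero; suc; _≤_)
open import Data.Fin using (Fin; zero; suc)
open import Data.Fin.Subset using (Subset; _∈_; _⊆_; ∣_∣; inside; outside)
open import Data.Vec using ([]; _∷_)
open import Data.Product using (Σ; ∃; _×_)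
open import Relation.Nullary using (¬_)
open import Relation.Binary.PropositionalEquality using (_≡_)
import Relation.Binary.PropositionalEquality as P
open import Function.Bundles using (Inverse)
open import Algebra.Bundles using (AbelianGroup)

record FiniteAbelianGroup (c ℓ : Level) (n : ℕ) : Set (Level.suc (c Level.⊔ ℓ)) where
  field
    abGroup : AbelianGroup c ℓ
  open AbelianGroup abGroup public hiding (group)
  field
    enum : Inverse setoid (P.setoid (Fin n))

  elt : Fin n → Carrier
  elt = Inverse.from enum

module _ {c ℓ} (G : AbelianGroup c ℓ) where
  open AbelianGroup G
  sumOver : ∀ {m} → (Fin m → Carrier) → Subset m → Carrier
  sumOver f [] = ε
  sumOver f (outside ∷ p) = sumOver (λ i → f (suc i)) p
  sumOver f (inside ∷ p) = f zero ∙ sumOver (λ i → f (suc i)) p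

module _ {c ℓ n} (G : FiniteAbelianGroup c ℓ n) where
  open FiniteAbelianGroup G

  -- Subsets of G are represented via the labelling by Fin n.
  -- s(A): sum of the elements of A
  s : Subset n → Carrier
  s A = sumOver abGroup elt A

  _∈G_ : Carrier → Subset n → Set ℓ
  x ∈G A = ∃ λ i → i ∈ A × elt i ≈ x

  _∈_^_ : Carrier → ℕ → Subset n → Set ℓ
  x ∈ h ^ A = ∃ λ B → B ⊆ A × ∣ B ∣ ≡ h × s B ≈ x

  IsZ : ℕ → ℕ → Set ℓ
  IsZ h m = (∃ λ A → ∣ A ∣ ≡ m × ¬ (ε ∈ h ^ A))
          × (∀ A → ¬ (ε ∈ h ^ A) → ∣ A ∣ ≤ m)

{-# OPTIONS --safe #-}
-- An (h+1)-subset A has exactly the h-subsets A ∖ {a}, with sums s(A) − a; hence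
-- 0 ∈ h^A iff s(A) ∈ A. Since h^A is monotone in A, a set of size at least h+1
-- avoiding 0 in h^A contains an (h+1)-subset A with s(A) ∉ A, and conversely such
-- an A is itself a witness for Z_h(G) ≥ h+1.
module Submission where

open import Defs
open import Level using (Level)
open import Data.Nat using (ℕ; zero; suc; _≤_; _<_; s≤s)
open import Data.Nat.Properties using (≤-trans; ≤-reflexive; suc-injective; ≤⇒≯)
open import Data.Fin using (Fin; zero; suc)
open import Data.Fin.Subset using (Subset; _∈_; _⊆_; ∣_∣; inside; outside; ⊥)
open import Data.Fin.Subset.Properties
  using (drop-∷-⊆; s⊆s; out⊆; ⊥⊆; ∣⊥∣≡0; ⊆-refl; ⊆-trans; p⊆q⇒∣p∣≤∣q∣)
open import Data.Vec using ([]; _∷_; here; there)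
open import Data.Product using (∃; _×_; _,_)
open import Relation.Nullary using (¬_; contradiction)
open import Relation.Binary.PropositionalEquality as ≡ using (_≡_; cong)
open import Function.Bundles using (_⇔_; mk⇔)
open import Algebra.Bundles using (AbelianGroup)
import Algebra.Properties.CommutativeSemigroup as CommutativeSemigroupProperties
import Algebra.Properties.Group as GroupProperties

p⊆q∧∣q∣≤∣p∣⇒p≡q : ∀ {m} {p q : Subset m} → p ⊆ q → ∣ q ∣ ≤ ∣ p ∣ → p ≡ q
p⊆q∧∣q∣≤∣p∣⇒p≡q {p = []}          {[]}          _   _ = ≡.refl
p⊆q∧∣q∣≤∣p∣⇒p≡q {p = outside ∷ p} {outside ∷ q} p⊆q le =
  cong (outside ∷_) (p⊆q∧∣q∣≤∣p∣⇒p≡q (drop-∷-⊆ p⊆q) le)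
p⊆q∧∣q∣≤∣p∣⇒p≡q {p = inside ∷ p}  {inside ∷ q}  p⊆q (s≤s le) =
  cong (inside ∷_) (p⊆q∧∣q∣≤∣p∣⇒p≡q (drop-∷-⊆ p⊆q) le)
p⊆q∧∣q∣≤∣p∣⇒p≡q {p = inside ∷ p}  {outside ∷ q} p⊆q _ with p⊆q here
... | ()
p⊆q∧∣q∣≤∣p∣⇒p≡q {p = outside ∷ p} {inside ∷ q}  p⊆q le =
  contradiction le (≤⇒≯ (p⊆q⇒∣p∣≤∣q∣ (drop-∷-⊆ p⊆q)))

∃⊆-of-size : ∀ {m} k (p : Subset m) → k ≤ ∣ p ∣ → ∃ λ q → q ⊆ p × ∣ q ∣ ≡ k
∃⊆-of-size {m} zero    p             _        = ⊥ , ⊥⊆ , ∣⊥∣≡0 m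
∃⊆-of-size (suc k) (outside ∷ p) le       with ∃⊆-of-size (suc k) p le
... | q , q⊆p , ∣q∣≡ = outside ∷ q , out⊆ q⊆p , ∣q∣≡
∃⊆-of-size (suc k) (inside ∷ p)  (s≤s le) with ∃⊆-of-size k p le
... | q , q⊆p , ∣q∣≡ = inside ∷ q , s⊆s q⊆p , cong suc ∣q∣≡

module _ {c ℓ} (G : AbelianGroup c ℓ) where
  open AbelianGroup G
  open CommutativeSemigroupProperties commutativeSemigroup using (x∙yz≈y∙xz)

  sumOver-∈ : ∀ {m} (f : Fin m → Carrier) {p : Subset m} {i} → i ∈ p →
              ∃ λ q → q ⊆ p × suc ∣ q ∣ ≡ ∣ p ∣ × sumOver G f p ≈ f i ∙ sumOver G f q
  sumOver-∈ f {inside ∷ p}  here      = outside ∷ p , out⊆ ⊆-refl , ≡.refl , refl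
  sumOver-∈ f {outside ∷ p} (there i∈p) with sumOver-∈ (λ j → f (suc j)) i∈p
  ... | q , q⊆p , ∣q∣≡ , sum≈ = outside ∷ q , s⊆s q⊆p , ∣q∣≡ , sum≈
  sumOver-∈ f {inside ∷ p}  (there i∈p) with sumOver-∈ (λ j → f (suc j)) i∈p
  ... | q , q⊆p , ∣q∣≡ , sum≈ =
    inside ∷ q , s⊆s q⊆p , cong suc ∣q∣≡ , trans (∙-congˡ sum≈) (x∙yz≈y∙xz _ _ _)

  sumOver-⊆-suc : ∀ {m} (f : Fin m → Carrier) {p q : Subset m} → q ⊆ p → ∣ p ∣ ≡ suc ∣ q ∣ →
                  ∃ λ i → i ∈ p × sumOver G f p ≈ f i ∙ sumOver G f q
  sumOver-⊆-suc f {inside ∷ p}  {outside ∷ q} q⊆p ∣p∣≡ =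
    zero , here ,
    ∙-congˡ (reflexive (cong (sumOver G _) (≡.sym (p⊆q∧∣q∣≤∣p∣⇒p≡q (drop-∷-⊆ q⊆p)
                                                  (≤-reflexive (suc-injective ∣p∣≡))))))
  sumOver-⊆-suc f {outside ∷ p} {outside ∷ q} q⊆p ∣p∣≡
    with sumOver-⊆-suc (λ j → f (suc j)) (drop-∷-⊆ q⊆p) ∣p∣≡
  ... | i , i∈p , sum≈ = suc i , there i∈p , sum≈
  sumOver-⊆-suc f {inside ∷ p}  {inside ∷ q}  q⊆p ∣p∣≡
    with sumOver-⊆-suc (λ j → f (suc j)) (drop-∷-⊆ q⊆p) (suc-injective ∣p∣≡)
  ... | i , i∈p , sum≈ = suc i , there i∈p , trans (∙-congˡ sum≈) (x∙yz≈y∙xz _ _ _)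
  sumOver-⊆-suc f {outside ∷ p} {inside ∷ q}  q⊆p _ with q⊆p here
  ... | ()

  open GroupProperties group using (∙-cancelˡ)

  x∙y≈x⇒y≈ε : ∀ {x y} → x ∙ y ≈ x → y ≈ ε
  x∙y≈x⇒y≈ε {x} {y} x∙y≈x = ∙-cancelˡ x y ε (trans x∙y≈x (sym (identityʳ x)))

  y≈ε⇒x∙y≈x : ∀ {x y} → y ≈ ε → x ∙ y ≈ x
  y≈ε⇒x∙y≈x {x} y≈ε = trans (∙-congˡ y≈ε) (identityʳ x)

module _ {c ℓ n} (G : FiniteAbelianGroup c ℓ n) where
  open FiniteAbelianGroup G

  ∈^-mono : ∀ {x h A A′} → A ⊆ A′ → _∈_^_ G x h A → _∈_^_ G x h A′
  ∈^-mono A⊆A′ (B , B⊆A , ∣B∣≡h , sB≈x) = B , ⊆-trans B⊆A A⊆A′ , ∣B∣≡h , sB≈x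

  ε∈^⇒s∈G : ∀ {h A} → ∣ A ∣ ≡ suc h → _∈_^_ G ε h A → _∈G_ G (s G A) A
  ε∈^⇒s∈G ∣A∣≡ (B , B⊆A , ∣B∣≡h , sB≈ε)
    with sumOver-⊆-suc abGroup elt B⊆A (≡.trans ∣A∣≡ (cong suc (≡.sym ∣B∣≡h)))
  ... | i , i∈A , sA≈ = i , i∈A , sym (trans sA≈ (y≈ε⇒x∙y≈x abGroup sB≈ε))

  s∈G⇒ε∈^ : ∀ {h A} → ∣ A ∣ ≡ suc h → _∈G_ G (s G A) A → _∈_^_ G ε h A
  s∈G⇒ε∈^ ∣A∣≡ (i , i∈A , eltᵢ≈sA) with sumOver-∈ abGroup elt i∈A
  ... | B , B⊆A , ∣B∣≡ , sA≈ =
    B , B⊆A , suc-injective (≡.trans ∣B∣≡ ∣A∣≡) ,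
    x∙y≈x⇒y≈ε abGroup (trans (sym sA≈) (sym eltᵢ≈sA))

proposition4p3 : ∀ {c ℓ : Level} (n : ℕ) (G : FiniteAbelianGroup c ℓ n) (h : ℕ)
    → 2 ≤ n → 1 ≤ h → h < n
    → (m : ℕ) → IsZ G h m
    → (suc h ≤ m) ⇔ (∃ λ A → ∣ A ∣ ≡ suc h × ¬ (_∈G_ G (s G A) A))
proposition4p3 n G h _ _ _ m ((A₀ , ∣A₀∣≡m , ε∉^A₀) , maximal) = mk⇔ to from
  where
  to : suc h ≤ m → ∃ λ A → ∣ A ∣ ≡ suc h × ¬ (_∈G_ G (s G A) A)
  to h<m with ∃⊆-of-size (suc h) A₀ (≤-trans h<m (≤-reflexive (≡.sym ∣A₀∣≡m)))
  ... | A , A⊆A₀ , ∣A∣≡ =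
    A , ∣A∣≡ , λ sA∈A → ε∉^A₀ (∈^-mono G A⊆A₀ (s∈G⇒ε∈^ G ∣A∣≡ sA∈A))

  from : (∃ λ A → ∣ A ∣ ≡ suc h × ¬ (_∈G_ G (s G A) A)) → suc h ≤ m
  from (A , ∣A∣≡ , sA∉A) =
    ≤-trans (≤-reflexive (≡.sym ∣A∣≡)) (maximal A (λ ε∈^A → sA∉A (ε∈^⇒s∈G G ∣A∣≡ ε∈^A)))
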